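{- Let $\mathcal{C}$ be a regular category with terminal object $\mathbf{1}$, let $A, B$ be objects, and let $R_a \rightarrowtail A \times B$ and $R_b \rightarrowtail B \times A$ be relations. Suppose that for every subobject $p \rightarrowtail A$ there is a global element $c : \mathbf{1} \to A$ such that, in the internal regular logic of $\mathcal{C}$ (variables $x : A$, $y : B$), the following sequents are valid: (A1) $R_a(c, y) \wedge R_b(y, x) \vdash_{\{x, y\}} p(x)$; (A2) $R_a(c, y) \wedge p(x) \vdash_{\{x, y\}} R_b(y, x)$; (A3) $\vdash \exists y.\, R_a(c, y)$. Let $R \rightarrowtail A \times A$ be the relational composite, $R(x_1, x_2) \equiv \exists y.\,[R_a(x_1, y) \wedge R_b(y, x_2)]$. Then $R$ is very weakly point surjective.
   Context: A regular category is a well-powered category with finite limits and pullback-stable images. Regular logic is interpreted in it as usual: sorts are objects, constants are global elements $\mathbf{1} \to A$, relation symbols are subobjects of products, substitution is pullback, conjunction is meet of subobjects (pullback), and $\exists$ is the left adjoint $\exists_\pi$ to pullback $\pi^*$ along a product projection; a sequent $\phi \vdash_X \psi$ is valid when $[\![\phi]\!] \le [\![\psi]\!]$ in $\mathsf{Sub}$ of the product of the sorts of $X$. A relation $R \rightarrowtail A \times A$ is very weakly point surjective if for every subobject $P \rightarrowtail A$ there is $c : \mathbf{1} \to A$ with $\langle c, c\rangle^*(R) = c^*(P)$ in $\mathsf{Sub}(\mathbf{1})$. -}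

module Defs where

open import Level using (Level; _⊔_) renaming (suc to lsuc)
open import Relation.Binary using (Rel; IsEquivalence; Setoid)
open import Data.Product using (Σ; _,_; proj₁; proj₂) renaming (_×_ to _∧_)
import Relation.Binary.Reasoning.Setoid as SetoidR

record Category (o ℓ e : Level) : Set (lsuc (o ⊔ ℓ ⊔ e)) where
  infix  4 _≈_
  infixr 9 _∘_
  infix  5 _⇒_
  field
    Obj       : Set o
    _⇒_       : Obj → Obj → Set ℓ
    _≈_       : ∀ {A B} → Rel (A ⇒ B) e
    id        : ∀ {A} → A ⇒ A
    _∘_       : ∀ {A B C} → B ⇒ C → A ⇒ B → A ⇒ C
    equiv     : ∀ {A B} → IsEquivalence (_≈_ {A} {B})
    ∘-resp-≈  : ∀ {A B C} {f h : B ⇒ C} {g i : A ⇒ B} → f ≈ h → g ≈ i → f ∘ g ≈ h ∘ i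
    assoc     : ∀ {A B C D} {f : A ⇒ B} {g : B ⇒ C} {h : C ⇒ D} → (h ∘ g) ∘ f ≈ h ∘ (g ∘ f)
    identityˡ : ∀ {A B} {f : A ⇒ B} → id ∘ f ≈ f
    identityʳ : ∀ {A B} {f : A ⇒ B} → f ∘ id ≈ f

  hom-setoid : Obj → Obj → Setoid ℓ e
  hom-setoid A B = record { Carrier = A ⇒ B ; _≈_ = _≈_ ; isEquivalence = equiv }

module Basics {o ℓ e : Level} (C : Category o ℓ e) where
  open Category C

  private
    module E {A B : Obj} = IsEquivalence (equiv {A} {B})

  Mono : ∀ {A B} → A ⇒ B → Set (o ⊔ ℓ ⊔ e)
  Mono {A} f = ∀ {X} (g h : X ⇒ A) → f ∘ g ≈ f ∘ h → g ≈ h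

  record Subobject (A : Obj) : Set (o ⊔ ℓ ⊔ e) where
    field
      dom  : Obj
      arr  : dom ⇒ A
      mono : Mono arr
  open Subobject public

  _≤ₛ_ : ∀ {A} → Subobject A → Subobject A → Set (ℓ ⊔ e)
  m ≤ₛ n = Σ (dom m ⇒ dom n) λ f → arr n ∘ f ≈ arr m

  _≅ₛ_ : ∀ {A} → Subobject A → Subobject A → Set (ℓ ⊔ e)
  m ≅ₛ n = (m ≤ₛ n) ∧ (n ≤ₛ m)

  ⊤ₛ : ∀ {A} → Subobject A
  ⊤ₛ {A} = record { dom = A ; arr = id ; mono = λ g h eq →
    E.trans (E.sym identityˡ) (E.trans eq identityˡ) }

  record Terminal : Set (o ⊔ ℓ ⊔ e) where
    field
      ⊤       : Obj
      !       : ∀ {A} → A ⇒ ⊤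
      !-unique : ∀ {A} (f : A ⇒ ⊤) → f ≈ !

  record Product (A B : Obj) : Set (o ⊔ ℓ ⊔ e) where
    field
      A×B      : Obj
      π₁       : A×B ⇒ A
      π₂       : A×B ⇒ B
      ⟨_,_⟩    : ∀ {X} → X ⇒ A → X ⇒ B → X ⇒ A×B
      project₁ : ∀ {X} {f : X ⇒ A} {g : X ⇒ B} → π₁ ∘ ⟨ f , g ⟩ ≈ f
      project₂ : ∀ {X} {f : X ⇒ A} {g : X ⇒ B} → π₂ ∘ ⟨ f , g ⟩ ≈ g
      unique   : ∀ {X} {f : X ⇒ A} {g : X ⇒ B} (h : X ⇒ A×B) →
                 π₁ ∘ h ≈ f → π₂ ∘ h ≈ g → h ≈ ⟨ f , g ⟩

  record Pullback {X Y Z : Obj} (f : X ⇒ Z) (g : Y ⇒ Z) : Set (o ⊔ ℓ ⊔ e) where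
    field
      P         : Obj
      p₁        : P ⇒ X
      p₂        : P ⇒ Y
      commute   : f ∘ p₁ ≈ g ∘ p₂
      universal : ∀ {Q} {h₁ : Q ⇒ X} {h₂ : Q ⇒ Y} → f ∘ h₁ ≈ g ∘ h₂ → Q ⇒ P
      p₁∘universal : ∀ {Q} {h₁ : Q ⇒ X} {h₂ : Q ⇒ Y} (eq : f ∘ h₁ ≈ g ∘ h₂) →
                     p₁ ∘ universal eq ≈ h₁
      p₂∘universal : ∀ {Q} {h₁ : Q ⇒ X} {h₂ : Q ⇒ Y} (eq : f ∘ h₁ ≈ g ∘ h₂) →
                     p₂ ∘ universal eq ≈ h₂
      unique    : ∀ {Q} {h₁ : Q ⇒ X} {h₂ : Q ⇒ Y} (eq : f ∘ h₁ ≈ g ∘ h₂) (i : Q ⇒ P) →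
                  p₁ ∘ i ≈ h₁ → p₂ ∘ i ≈ h₂ → i ≈ universal eq

  record FiniteLimits : Set (o ⊔ ℓ ⊔ e) where
    field
      terminal : Terminal
      product  : ∀ A B → Product A B
      pullback : ∀ {X Y Z} (f : X ⇒ Z) (g : Y ⇒ Z) → Pullback f g

  ∘-mono : ∀ {A B D} {f : B ⇒ D} {g : A ⇒ B} → Mono f → Mono g → Mono (f ∘ g)
  ∘-mono {f = f} {g} mf mg u v eq =
    mg u v (mf (g ∘ u) (g ∘ v)
      (E.trans (E.sym assoc) (E.trans eq assoc)))

  pullback-mono : ∀ {X Y Z} {f : X ⇒ Z} {g : Y ⇒ Z} (pb : Pullback f g) →
                  Mono f → Mono (Pullback.p₂ pb)
  pullback-mono {f = f} {g} pb mf {Q} u v eq =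
      E.trans (unique eqU u E.refl E.refl)
        (E.sym (E.trans (unique eqU v (E.sym p₁eq) (E.sym eq)) E.refl))
    where
      open Pullback pb
      open SetoidR (hom-setoid Q _)
      eqU : f ∘ (p₁ ∘ u) ≈ g ∘ (p₂ ∘ u)
      eqU = begin
        f ∘ (p₁ ∘ u) ≈⟨ E.sym assoc ⟩
        (f ∘ p₁) ∘ u ≈⟨ ∘-resp-≈ commute E.refl ⟩
        (g ∘ p₂) ∘ u ≈⟨ assoc ⟩
        g ∘ (p₂ ∘ u) ∎
      p₁eq : p₁ ∘ u ≈ p₁ ∘ v
      p₁eq = mf (p₁ ∘ u) (p₁ ∘ v) (begin
        f ∘ (p₁ ∘ u) ≈⟨ eqU ⟩
        g ∘ (p₂ ∘ u) ≈⟨ ∘-resp-≈ E.refl eq ⟩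
        g ∘ (p₂ ∘ v) ≈⟨ E.sym assoc ⟩
        (g ∘ p₂) ∘ v ≈⟨ ∘-resp-≈ (E.sym commute) E.refl ⟩
        (f ∘ p₁) ∘ v ≈⟨ assoc ⟩
        f ∘ (p₁ ∘ v) ∎)

  module WithLimits (L : FiniteLimits) where
    open FiniteLimits L
    open Terminal terminal public

    infixr 10 _⊗_
    _⊗_ : Obj → Obj → Obj
    A ⊗ B = Product.A×B (product A B)

    π₁ : ∀ {A B} → A ⊗ B ⇒ A
    π₁ {A} {B} = Product.π₁ (product A B)

    π₂ : ∀ {A B} → A ⊗ B ⇒ B
    π₂ {A} {B} = Product.π₂ (product A B)

    ⟨_,_⟩ : ∀ {X A B} → X ⇒ A → X ⇒ B → X ⇒ A ⊗ B
    ⟨_,_⟩ {A = A} {B} = Product.⟨_,_⟩ (product A B)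

    _* : ∀ {X A} → X ⇒ A → Subobject A → Subobject X
    (f *) m = record
      { dom  = Pullback.P pb
      ; arr  = Pullback.p₂ pb
      ; mono = pullback-mono pb (mono m) }
      where pb = pullback (arr m) f

    _∧ₛ_ : ∀ {A} → Subobject A → Subobject A → Subobject A
    m ∧ₛ n = record
      { dom  = dom ((arr m *) n)
      ; arr  = arr m ∘ arr ((arr m *) n)
      ; mono = ∘-mono (mono m) (mono ((arr m *) n)) }

    record Image {X A : Obj} (f : X ⇒ A) : Set (o ⊔ ℓ ⊔ e) where
      field
        sub        : Subobject A
        factor     : X ⇒ dom sub
        factorizes : arr sub ∘ factor ≈ f
        least      : (m : Subobject A) (g : X ⇒ dom m) → arr m ∘ g ≈ f → sub ≤ₛ m

record RegularCategory (o ℓ e : Level) : Set (lsuc (o ⊔ ℓ ⊔ e)) where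
  field
    cat    : Category o ℓ e
  open Category cat public
  open Basics cat public
  field
    limits : FiniteLimits
  open WithLimits limits public
  field
    image  : ∀ {X A} (f : X ⇒ A) → Image f
    image-stable : ∀ {X Y A} (f : X ⇒ A) (g : Y ⇒ A) →
      Image.sub (image (Pullback.p₂ (FiniteLimits.pullback limits f g)))
        ≅ₛ (g *) (Image.sub (image f))

  ∃ₛ : ∀ {X Y} → X ⇒ Y → Subobject X → Subobject Y
  ∃ₛ f m = Image.sub (image (f ∘ arr m))

module Lemma6Defs {o ℓ e : Level} (𝒞 : RegularCategory o ℓ e) where
  open RegularCategory 𝒞

  VeryWeaklyPointSurjective : ∀ {A} → Subobject (A ⊗ A) → Set (o ⊔ ℓ ⊔ e)
  VeryWeaklyPointSurjective {A} R =
    (P : Subobject A) → Σ (⊤ ⇒ A) λ c → (⟨ c , c ⟩ *) R ≅ₛ (c *) P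

  -- relational composite R(x₁,x₂) ≡ ∃y. Ra(x₁,y) ∧ Rb(y,x₂),
  -- context {x₁ : A, x₂ : A, y : B} interpreted as (A ⊗ A) ⊗ B
  compose : ∀ {A B} → Subobject (A ⊗ B) → Subobject (B ⊗ A) → Subobject (A ⊗ A)
  compose Ra Rb =
    ∃ₛ π₁ ((⟨ π₁ ∘ π₁ , π₂ ⟩ *) Ra ∧ₛ (⟨ π₂ , π₂ ∘ π₁ ⟩ *) Rb)

  -- in context {x : A, y : B} (interpreted as A ⊗ B):
  -- Ra(c, y)
  Ra[c,y] : ∀ {A B} → Subobject (A ⊗ B) → ⊤ ⇒ A → Subobject (A ⊗ B)
  Ra[c,y] Ra c = (⟨ c ∘ ! , π₂ ⟩ *) Ra
  Rb[y,x] : ∀ {A B} → Subobject (B ⊗ A) → Subobject (A ⊗ B)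
  Rb[y,x] Rb = (⟨ π₂ , π₁ ⟩ *) Rb
  p[x] : ∀ {A B} → Subobject A → Subobject (A ⊗ B)
  p[x] p = (π₁ *) p

  A1 : ∀ {A B} → Subobject (A ⊗ B) → Subobject (B ⊗ A) → Subobject A → ⊤ ⇒ A → Set (ℓ ⊔ e)
  A1 {A} {B} Ra Rb p c = (Ra[c,y] Ra c ∧ₛ Rb[y,x] Rb) ≤ₛ p[x] {A} {B} p

  A2 : ∀ {A B} → Subobject (A ⊗ B) → Subobject (B ⊗ A) → Subobject A → ⊤ ⇒ A → Set (ℓ ⊔ e)
  A2 {A} {B} Ra Rb p c = (Ra[c,y] Ra c ∧ₛ p[x] {A} {B} p) ≤ₛ Rb[y,x] Rb

  -- (A3) ⊢ ∃y. Ra(c,y); the formula Ra(c,y) lives in context {y : B},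
  -- the empty context is interpreted as ⊤
  A3 : ∀ {A B} → Subobject (A ⊗ B) → ⊤ ⇒ A → Set (ℓ ⊔ e)
  A3 {A} {B} Ra c = ⊤ₛ ≤ₛ ∃ₛ (! {B}) ((⟨ c ∘ ! , id ⟩ *) Ra)

-- We reason with generalized elements z : Q ⇒ X, reading "z factors through S"
-- as "S(z) holds"; pullback, meet and ∃ then have the usual introduction and
-- elimination rules, and pullback-stability of images is exactly what makes
-- ∃-elimination sound in every context. Given P, take the point c supplied by
-- the hypothesis. If R(c,c), i.e. Ra(c,y) ∧ Rb(y,c) for some y, then P(c) by
-- (A1). Conversely, if P(c), then (A3) yields, locally, some y with Ra(c,y),
-- whence Rb(y,c) by (A2), and so R(c,c).
module Submission where

open import Defs
open import Level using (Level; _⊔_)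
open import Data.Product using (Σ; _,_; proj₂) renaming (_×_ to _∧_)
open import Function using (_∘′_)
open import Relation.Binary using (IsEquivalence)

module GeneralizedElements {o ℓ e : Level} (𝒞 : RegularCategory o ℓ e) where
  open RegularCategory 𝒞
  open module ≈ {X Y : Obj} = IsEquivalence (equiv {X} {Y})
    public using () renaming (refl to ≈-refl; sym to ≈-sym; trans to ≈-trans)

  -- S ≤ₛ T is literally T ∋ arr S.
  infix 4 _∋_
  _∋_ : ∀ {X Q} → Subobject X → Q ⇒ X → Set (ℓ ⊔ e)
  _∋_ {Q = Q} S z = Σ (Q ⇒ dom S) λ a → arr S ∘ a ≈ z

  pullʳ : ∀ {W X Y Z} {f : Y ⇒ Z} {k : X ⇒ Y} {s : W ⇒ X} {t : W ⇒ Y} →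
          k ∘ s ≈ t → (f ∘ k) ∘ s ≈ f ∘ t
  pullʳ ks≈t = ≈-trans assoc (∘-resp-≈ ≈-refl ks≈t)

  pullˡ : ∀ {W X Y Z} {f : Y ⇒ Z} {g : X ⇒ Y} {h : X ⇒ Z} {s : W ⇒ X} →
          f ∘ g ≈ h → f ∘ (g ∘ s) ≈ h ∘ s
  pullˡ fg≈h = ≈-trans (≈-sym assoc) (∘-resp-≈ fg≈h ≈-refl)

  ∋-resp-≈ : ∀ {X Q} (S : Subobject X) {z z′ : Q ⇒ X} → z ≈ z′ → S ∋ z → S ∋ z′
  ∋-resp-≈ S z≈z′ (a , Sa) = a , ≈-trans Sa z≈z′

  ∋-∘ : ∀ {X Q Q′} (S : Subobject X) {z : Q ⇒ X} (h : Q′ ⇒ Q) → S ∋ z → S ∋ z ∘ h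
  ∋-∘ S h (a , Sa) = a ∘ h , pullˡ Sa

  ∋-arr : ∀ {X} (S : Subobject X) → S ∋ arr S
  ∋-arr S = id , identityʳ

  ≤ₛ-∋ : ∀ {X Q} {S T : Subobject X} {z : Q ⇒ X} → S ≤ₛ T → S ∋ z → T ∋ z
  ≤ₛ-∋ {T = T} (f , Tf) (a , Sa) = ∋-resp-≈ T Sa (∋-∘ T a (f , Tf))

  *-intro : ∀ {X Y Q} (f : Y ⇒ X) (S : Subobject X) {z : Q ⇒ Y} →
            S ∋ f ∘ z → (f *) S ∋ z
  *-intro f S (a , Sa) = universal Sa , p₂∘universal Sa
    where open Pullback (FiniteLimits.pullback limits (arr S) f)

  *-elim : ∀ {X Y Q} (f : Y ⇒ X) (S : Subobject X) {z : Q ⇒ Y} →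
           (f *) S ∋ z → S ∋ f ∘ z
  *-elim f S (a , p₂a≈z) = p₁ ∘ a , ≈-trans (pullˡ commute) (pullʳ p₂a≈z)
    where open Pullback (FiniteLimits.pullback limits (arr S) f)

  ∧ₛ-intro : ∀ {X Q} (S T : Subobject X) {z : Q ⇒ X} → S ∋ z → T ∋ z → S ∧ₛ T ∋ z
  ∧ₛ-intro S T (a , Sa≈z) T∋z with *-intro (arr S) T (∋-resp-≈ T (≈-sym Sa≈z) T∋z)
  ... | t , t≈a = t , ≈-trans (pullʳ t≈a) Sa≈z

  ∧ₛ-elimˡ : ∀ {X Q} (S T : Subobject X) {z : Q ⇒ X} → S ∧ₛ T ∋ z → S ∋ z
  ∧ₛ-elimˡ S T (a , STa) = arr ((arr S *) T) ∘ a , ≈-trans (≈-sym assoc) STa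

  ∧ₛ-elimʳ : ∀ {X Q} (S T : Subobject X) {z : Q ⇒ X} → S ∧ₛ T ∋ z → T ∋ z
  ∧ₛ-elimʳ S T (a , STa) =
    ∋-resp-≈ T (≈-trans (≈-sym assoc) STa)
      (*-elim (arr S) T (∋-∘ ((arr S *) T) a (∋-arr ((arr S *) T))))

  ∃ₛ-intro : ∀ {X Y Q} (h : X ⇒ Y) (S : Subobject X) {z : Q ⇒ X} →
             S ∋ z → ∃ₛ h S ∋ h ∘ z
  ∃ₛ-intro h S (a , Sa) = ∋-resp-≈ (∃ₛ h S) (pullʳ Sa) (∋-∘ (∃ₛ h S) a (factor , factorizes))
    where open Image (image (h ∘ arr S))

  image-least : ∀ {X Y} (f : X ⇒ Y) (T : Subobject Y) → T ∋ f → Image.sub (image f) ≤ₛ T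
  image-least f T (a , Ta≈f) = Image.least (image f) T a Ta≈f

  ∃ₛ-pullback-elim : ∀ {X Y Z} {h : X ⇒ Y} {S : Subobject X} {g : Z ⇒ Y} (T : Subobject Z) →
    (∀ {Q} (z : Q ⇒ Z) {s : Q ⇒ X} → S ∋ s → h ∘ s ≈ g ∘ z → T ∋ z) →
    (g *) (∃ₛ h S) ≤ₛ T
  ∃ₛ-pullback-elim {h = h} {S} {g} T witness =
    ≤ₛ-∋ {S = Image.sub (image p₂)} {T}
      (image-least p₂ T (witness p₂ (∋-∘ S p₁ (∋-arr S)) (≈-trans (≈-sym assoc) commute)))
      (proj₂ (image-stable (h ∘ arr S) g))
    where open Pullback (FiniteLimits.pullback limits (h ∘ arr S) g)

  ∃ₛ-elim : ∀ {X Y Z} {h : X ⇒ Y} {S : Subobject X} {g : Z ⇒ Y} (T : Subobject Z) →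
    ∃ₛ h S ∋ g →
    (∀ {Q} (z : Q ⇒ Z) {s : Q ⇒ X} → S ∋ s → h ∘ s ≈ g ∘ z → T ∋ z) →
    T ∋ id
  ∃ₛ-elim {h = h} {S} {g} T ∃ₛhS∋g witness =
    ≤ₛ-∋ {S = (g *) (∃ₛ h S)} {T} (∃ₛ-pullback-elim {h = h} {S} {g} T witness)
      (*-intro g (∃ₛ h S) (∋-resp-≈ (∃ₛ h S) (≈-sym identityʳ) ∃ₛhS∋g))

  !-unique₂ : ∀ {Q} (u v : Q ⇒ ⊤) → u ≈ v
  !-unique₂ u v = ≈-trans (!-unique u) (≈-sym (!-unique v))

  module _ {A B : Obj} where
    open Product (FiniteLimits.product limits A B) public
      using () renaming (project₁ to π₁∘⟨⟩; project₂ to π₂∘⟨⟩)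
    open Product (FiniteLimits.product limits A B) using (unique)

    ⟨⟩-cong : ∀ {X} {f f′ : X ⇒ A} {g g′ : X ⇒ B} → f ≈ f′ → g ≈ g′ → ⟨ f , g ⟩ ≈ ⟨ f′ , g′ ⟩
    ⟨⟩-cong f≈f′ g≈g′ = unique _ (≈-trans π₁∘⟨⟩ f≈f′) (≈-trans π₂∘⟨⟩ g≈g′)

    ⟨⟩∘ : ∀ {X W} {f : X ⇒ A} {g : X ⇒ B} {h : W ⇒ X} → ⟨ f , g ⟩ ∘ h ≈ ⟨ f ∘ h , g ∘ h ⟩
    ⟨⟩∘ = unique _ (pullˡ π₁∘⟨⟩) (pullˡ π₂∘⟨⟩)

    *⟨⟩-intro : ∀ {X Q} (S : Subobject (A ⊗ B)) {f : X ⇒ A} {g : X ⇒ B} {z : Q ⇒ X} →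
                S ∋ ⟨ f ∘ z , g ∘ z ⟩ → (⟨ f , g ⟩ *) S ∋ z
    *⟨⟩-intro S = *-intro _ S ∘′ ∋-resp-≈ S (≈-sym ⟨⟩∘)

    *⟨⟩-elim : ∀ {X Q} (S : Subobject (A ⊗ B)) {f : X ⇒ A} {g : X ⇒ B} {z : Q ⇒ X} →
               (⟨ f , g ⟩ *) S ∋ z → S ∋ ⟨ f ∘ z , g ∘ z ⟩
    *⟨⟩-elim S = ∋-resp-≈ S ⟨⟩∘ ∘′ *-elim _ S

module RelationalComposite {o ℓ e : Level} (𝒞 : RegularCategory o ℓ e) where
  open RegularCategory 𝒞
  open Lemma6Defs 𝒞
  open GeneralizedElements 𝒞

  module _ {A B : Obj} (Ra : Subobject (A ⊗ B)) (Rb : Subobject (B ⊗ A)) where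
    private
      Ra[x₁,y] Rb[y,x₂] : Subobject ((A ⊗ A) ⊗ B)
      Ra[x₁,y] = (⟨ π₁ ∘ π₁ , π₂ ⟩ *) Ra
      Rb[y,x₂] = (⟨ π₂ , π₂ ∘ π₁ ⟩ *) Rb

    compose-intro : ∀ {Q} {x₁ x₂ : Q ⇒ A} {y : Q ⇒ B} →
      Ra ∋ ⟨ x₁ , y ⟩ → Rb ∋ ⟨ y , x₂ ⟩ → compose Ra Rb ∋ ⟨ x₁ , x₂ ⟩
    compose-intro Ra∋ Rb∋ =
      ∋-resp-≈ (compose Ra Rb) π₁∘⟨⟩ (∃ₛ-intro π₁ (Ra[x₁,y] ∧ₛ Rb[y,x₂])
        (∧ₛ-intro Ra[x₁,y] Rb[y,x₂]
          (*⟨⟩-intro Ra (∋-resp-≈ Ra (⟨⟩-cong (≈-sym (≈-trans (pullʳ π₁∘⟨⟩) π₁∘⟨⟩))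
                                              (≈-sym π₂∘⟨⟩)) Ra∋))
          (*⟨⟩-intro Rb (∋-resp-≈ Rb (⟨⟩-cong (≈-sym π₂∘⟨⟩)
                                              (≈-sym (≈-trans (pullʳ π₁∘⟨⟩) π₂∘⟨⟩))) Rb∋))))

    compose-pullback-elim : ∀ {Z} {g : Z ⇒ A ⊗ A} (T : Subobject Z) →
      (∀ {Q} (z : Q ⇒ Z) {y : Q ⇒ B} →
         Ra ∋ ⟨ π₁ ∘ g ∘ z , y ⟩ → Rb ∋ ⟨ y , π₂ ∘ g ∘ z ⟩ → T ∋ z) →
      (g *) (compose Ra Rb) ≤ₛ T
    compose-pullback-elim {g = g} T witness =
      ∃ₛ-pullback-elim {h = π₁} {Ra[x₁,y] ∧ₛ Rb[y,x₂]} {g} T λ z {s} W∋s π₁s≈gz →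
      witness z
        (∋-resp-≈ Ra (⟨⟩-cong (pullʳ π₁s≈gz) ≈-refl) (*⟨⟩-elim Ra (∧ₛ-elimˡ Ra[x₁,y] Rb[y,x₂] W∋s)))
        (∋-resp-≈ Rb (⟨⟩-cong ≈-refl (pullʳ π₁s≈gz)) (*⟨⟩-elim Rb (∧ₛ-elimʳ Ra[x₁,y] Rb[y,x₂] W∋s)))

module PointSurjectivity {o ℓ e : Level} (𝒞 : RegularCategory o ℓ e) where
  open RegularCategory 𝒞
  open Lemma6Defs 𝒞
  open GeneralizedElements 𝒞
  open RelationalComposite 𝒞

  module _ {A B : Obj} where

    Ra[c,y]-intro : ∀ {Q} (Ra : Subobject (A ⊗ B)) {c : ⊤ ⇒ A} {x : Q ⇒ A} {y : Q ⇒ B}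
      (u : Q ⇒ ⊤) → Ra ∋ ⟨ c ∘ u , y ⟩ → Ra[c,y] Ra c ∋ ⟨ x , y ⟩
    Ra[c,y]-intro Ra u =
      *⟨⟩-intro Ra ∘′ ∋-resp-≈ Ra (⟨⟩-cong (≈-sym (pullʳ (!-unique₂ _ u))) (≈-sym π₂∘⟨⟩))

    Rb[y,x]-intro : ∀ {Q} (Rb : Subobject (B ⊗ A)) {x : Q ⇒ A} {y : Q ⇒ B} →
      Rb ∋ ⟨ y , x ⟩ → Rb[y,x] {A} {B} Rb ∋ ⟨ x , y ⟩
    Rb[y,x]-intro Rb = *⟨⟩-intro Rb ∘′ ∋-resp-≈ Rb (⟨⟩-cong (≈-sym π₂∘⟨⟩) (≈-sym π₁∘⟨⟩))

    Rb[y,x]-elim : ∀ {Q} (Rb : Subobject (B ⊗ A)) {x : Q ⇒ A} {y : Q ⇒ B} →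
      Rb[y,x] {A} {B} Rb ∋ ⟨ x , y ⟩ → Rb ∋ ⟨ y , x ⟩
    Rb[y,x]-elim Rb = ∋-resp-≈ Rb (⟨⟩-cong π₂∘⟨⟩ π₁∘⟨⟩) ∘′ *⟨⟩-elim Rb

    p[x]-intro : ∀ {Q} (P : Subobject A) {x : Q ⇒ A} {y : Q ⇒ B} →
      P ∋ x → p[x] {A} {B} P ∋ ⟨ x , y ⟩
    p[x]-intro P = *-intro π₁ P ∘′ ∋-resp-≈ P (≈-sym π₁∘⟨⟩)

    p[x]-elim : ∀ {Q} (P : Subobject A) {x : Q ⇒ A} {y : Q ⇒ B} →
      p[x] {A} {B} P ∋ ⟨ x , y ⟩ → P ∋ x
    p[x]-elim P = ∋-resp-≈ P π₁∘⟨⟩ ∘′ *-elim π₁ P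

  module _ {A B : Obj} (Ra : Subobject (A ⊗ B)) (Rb : Subobject (B ⊗ A))
           (P : Subobject A) (c : ⊤ ⇒ A) where

    A1-∋ : A1 Ra Rb P c → ∀ {Q} {x : Q ⇒ A} {y : Q ⇒ B} (u : Q ⇒ ⊤) →
      Ra ∋ ⟨ c ∘ u , y ⟩ → Rb ∋ ⟨ y , x ⟩ → P ∋ x
    A1-∋ a1 u Ra∋ Rb∋ = p[x]-elim P (≤ₛ-∋ {S = Ra[c,y] Ra c ∧ₛ Rb[y,x] Rb} {p[x] {A} {B} P} a1
      (∧ₛ-intro (Ra[c,y] Ra c) (Rb[y,x] {A} {B} Rb)
        (Ra[c,y]-intro Ra u Ra∋) (Rb[y,x]-intro Rb Rb∋)))

    A2-∋ : A2 Ra Rb P c → ∀ {Q} {x : Q ⇒ A} {y : Q ⇒ B} (u : Q ⇒ ⊤) →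
      Ra ∋ ⟨ c ∘ u , y ⟩ → P ∋ x → Rb ∋ ⟨ y , x ⟩
    A2-∋ a2 u Ra∋ P∋ = Rb[y,x]-elim Rb (≤ₛ-∋ {S = Ra[c,y] Ra c ∧ₛ p[x] P} {Rb[y,x] {A} {B} Rb} a2
      (∧ₛ-intro (Ra[c,y] Ra c) (p[x] {A} {B} P) (Ra[c,y]-intro Ra u Ra∋) (p[x]-intro P P∋)))

    A3-elim : A3 {A} {B} Ra c → ∀ {Z} (T : Subobject Z) →
      (∀ {Q} (z : Q ⇒ Z) {y : Q ⇒ B} → Ra ∋ ⟨ c ∘ ! , y ⟩ → T ∋ z) → T ∋ id
    A3-elim a3 T witness = ∃ₛ-elim {h = !} {Ra[c,-]} {g = !} T
      (∋-resp-≈ (∃ₛ ! Ra[c,-]) identityˡ (∋-∘ (∃ₛ ! Ra[c,-]) ! a3))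
      λ z Ra[c,-]∋y _ → witness z (∋-resp-≈ Ra (⟨⟩-cong (pullʳ (!-unique₂ _ _)) identityˡ)
                                              (*⟨⟩-elim Ra Ra[c,-]∋y))
      where
        Ra[c,-] : Subobject B
        Ra[c,-] = (⟨ c ∘ ! , id ⟩ *) Ra

    compose-at-c≅P : A1 Ra Rb P c → A2 Ra Rb P c → A3 {A} {B} Ra c →
      (⟨ c , c ⟩ *) (compose Ra Rb) ≅ₛ (c *) P
    compose-at-c≅P a1 a2 a3 = R[c,c]≤P[c] , P[c]≤R[c,c]
      where
        R[c,c] : Subobject ⊤
        R[c,c] = (⟨ c , c ⟩ *) (compose Ra Rb)

        R[c,c]≤P[c] : R[c,c] ≤ₛ (c *) P
        R[c,c]≤P[c] = compose-pullback-elim Ra Rb ((c *) P) λ z Ra∋ Rb∋ →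
          *-intro c P (A1-∋ a1 z (∋-resp-≈ Ra (⟨⟩-cong (pullˡ π₁∘⟨⟩) ≈-refl) Ra∋)
                                 (∋-resp-≈ Rb (⟨⟩-cong ≈-refl (pullˡ π₂∘⟨⟩)) Rb∋))

        d : dom ((c *) P) ⇒ ⊤
        d = arr ((c *) P)

        P[c]≤R[c,c] : (c *) P ≤ₛ R[c,c]
        P[c]≤R[c,c] =
          ∋-resp-≈ R[c,c] identityʳ (*-elim d R[c,c] (A3-elim a3 ((d *) R[c,c]) R[c,c]-along-d))
          where
            R[c,c]-along-d : ∀ {Q} (z : Q ⇒ dom ((c *) P)) {y : Q ⇒ B} →
              Ra ∋ ⟨ c ∘ ! , y ⟩ → (d *) R[c,c] ∋ z
            R[c,c]-along-d z {y} Ra∋ = *-intro d R[c,c] (*-intro ⟨ c , c ⟩ (compose Ra Rb)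
              (∋-resp-≈ (compose Ra Rb) (≈-sym ⟨⟩∘) (compose-intro Ra Rb Ra∋x (A2-∋ a2 ! Ra∋ P∋x))))
              where
                Ra∋x : Ra ∋ ⟨ c ∘ (d ∘ z) , y ⟩
                Ra∋x = ∋-resp-≈ Ra (⟨⟩-cong (∘-resp-≈ ≈-refl (!-unique₂ _ _)) ≈-refl) Ra∋

                P∋x : P ∋ c ∘ (d ∘ z)
                P∋x = ∋-resp-≈ P assoc (∋-∘ P z (*-elim c P (∋-arr ((c *) P))))

lemma6 : ∀ {o ℓ e : Level} (𝒞 : RegularCategory o ℓ e) →
    let open RegularCategory 𝒞 in let open Lemma6Defs 𝒞 in
    ∀ {A B : Obj} (Ra : Subobject (A ⊗ B)) (Rb : Subobject (B ⊗ A)) →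
    ((p : Subobject A) → Σ (⊤ ⇒ A) λ c → A1 Ra Rb p c ∧ (A2 Ra Rb p c ∧ A3 {A} {B} Ra c)) →
    VeryWeaklyPointSurjective (compose Ra Rb)
lemma6 𝒞 Ra Rb hypothesis P with hypothesis P
... | c , a1 , a2 , a3 = c , compose-at-c≅P Ra Rb P c a1 a2 a3
  where open PointSurjectivity 𝒞
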